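{- Assume the grading is strong. For each quotient-up-component $\underline C_k$ in dimension $k$ of $\underline\Gamma$, the distribution $\pi_{\underline C_k}(\underline u)=\mathrm{LP}(\underline u)\mathrm{RP}(\underline u)/K_{\underline C_k}$ ($\underline u\in\underline C_k$), where $K_{\underline C_k}$ is the number of root-to-leaf paths containing a node of $\underline C_k$, satisfies the reversibility condition for the quotient up-walk; hence it is the stationary distribution associated with $\underline C_k$. Moreover, the distribution $\pi_{C_k}(u)=\pi_{\underline C_k}(\underline u)/2=\mathrm{LP}(\underline u)\mathrm{RP}(\underline u)/(2K_{\underline C_k})$ on $C_k=\{u:\underline u\in\underline C_k\}$ satisfies the reversibility condition for the up-walk on $\Gamma$. The same holds with "up" replaced by "down".
   Context: A double cover of a graded signed graph is $\Gamma=(X,E,[\cdot:\cdot],\dim,-)$: $X$ finite nonempty, $E$ directed edges ($u\subset v$), signature $[v:u]\in\{\pm1\}$, $\dim:X\to\mathbb Z$, $-$ a fixed-point-free involution, with $u\subset v\Rightarrow\dim u<\dim v$, $-u\subset v$, $u\subset-v$, $[-v:u]=[v:-u]=-[v:u]$, and $\dim(-u)=\dim u$. Strong grading: $u\subset v\Rightarrow\dim v=\dim u+1$. Quotient $\underline\Gamma$: nodes $\underline u=\{u,-u\}$, edges $\underline u\subset\underline v$ iff $u\subset v$. Leaf: no $\underline v\supset\underline u$; root: no $\underline t\subset\underline u$. $\mathrm{LP}=1$ on leaves, $\sum_{\underline v\supset\underline u}\mathrm{LP}(\underline v)$ otherwise; $\mathrm{RP}=1$ on roots, $\sum_{\underline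 t\subset\underline u}\mathrm{RP}(\underline t)$ otherwise. A root-to-leaf path is a sequence $\underline w_0\subset\dots\subset\underline w_n$ from a root to a leaf. Up-walk on $X_k$: for $\underline u$ not a leaf, $P(u,u')=\sum\frac{\mathrm{LP}(\underline v)\mathrm{RP}(\underline u')}{\mathrm{LP}(\underline u)\mathrm{RP}(\underline v)}$ over $v\in X$ with $v\supset u,u'$, $[v:u]=1$, $[v:u']=-1$; for $\underline u$ a leaf, $P(u,u')=1/2$ if $u'\in\{\pm u\}$ and $0$ otherwise. Quotient up-walk on $\underline X_k$: for $\underline u$ not a leaf, $P(\underline u,\underline u')=\sum_{\underline v\supset\underline u,\underline u'}\frac{\mathrm{LP}(\underline v)\mathrm{RP}(\underline u')}{\mathrm{LP}(\underline u)\mathrm{RP}(\underline v)}$; for leaves $P(\underline u,\underline u)=1$. Down-walks dually: for $\underline u$ not a root, $P(u,u')=\sum\frac{\mathrm{RP}(\underline t)\mathrm{LP}(\underline u')}{\mathrm{RP}(\underline u)\mathrm{LP}(\underline t)}$ over $t\subset u,u'$, $[u:t]=-1$, $[u':t]=1$ (quotient: over $\underline t\subset\underline u,\underline u'$); for roots $P(u,\pm u)=1/2$ (quotient $1$). Quotient-up-(down-)components in dimension $k$: maximal subsets of $\underline X_k$ connected under up-adjacency (distinct nodes lying below a common node of dimension $k+1$), resp. down-adjacency (distinct nodes lying above a common node of dimension $k-1$). -}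

module Defs where

open import Data.Nat as ℕ using (ℕ; zero; suc)
open import Data.Integer as ℤ using (ℤ)
open import Data.Rational as ℚ using (ℚ; 0ℚ; 1ℚ)
open import Data.Fin using (Fin; zero; suc)
open import Data.Fin.Properties as FinP using ()
open import Data.Bool using (Bool; true; false; not; _∧_; _∨_; if_then_else_)
open import Data.Sign as Sign using (Sign)
import Data.Sign.Properties as SignP
open import Data.Product using (_×_; _,_; proj₁; proj₂; ∃; Σ)
open import Data.List using (List; []; _∷_)
open import Data.List.Relation.Unary.Any using (Any)
open import Data.List.Membership.Propositional using (_∈_)
open import Data.List.Relation.Unary.Unique.Propositional using (Unique)
open import Relation.Binary.PropositionalEquality using (_≡_; _≢_)
open import Relation.Binary.Construct.Closure.ReflexiveTransitive using (Star)
open import Relation.Nullary using (does)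
open import Data.Empty using (⊥)

sumℚ : ∀ {m} → (Fin m → ℚ) → ℚ
sumℚ {zero}  f = 0ℚ
sumℚ {suc m} f = f zero ℚ.+ sumℚ (λ i → f (suc i))

sumℕ : ∀ {m} → (Fin m → ℕ) → ℕ
sumℕ {zero}  f = 0
sumℕ {suc m} f = f zero ℕ.+ sumℕ (λ i → f (suc i))

anyᵇ : ∀ {m} → (Fin m → Bool) → Bool
anyᵇ {zero}  f = false
anyᵇ {suc m} f = f zero ∨ anyᵇ (λ i → f (suc i))

-- the quotient n / d of natural numbers as a rational
-- (convention: n / 0 = 0; all denominators used below are positive)
_÷ℕ_ : ℕ → ℕ → ℚ
n ÷ℕ zero  = 0ℚ
n ÷ℕ suc d = ℤ.+ n ℚ./ suc d

½ : ℚ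
½ = 1 ÷ℕ 2

-- Double covers of graded signed graphs.
-- The node set X is (w.l.o.g.) Fin m × Bool, with the involution
-- u ↦ -u flipping the Bool; the quotient node of (i , b) is i : Fin m.

Node : ℕ → Set
Node m = Fin m × Bool

neg : ∀ {m} → Node m → Node m
neg (i , b) = (i , not b)

sumX : ∀ {m} → (Node m → ℚ) → ℚ
sumX f = sumℚ (λ j → f (j , false) ℚ.+ f (j , true))

record DoubleCover (m : ℕ) : Set where
  field
    _⊂_ : Node m → Node m → Bool
    sig : Node m → Node m → Sign       -- sig v u = [v : u]
    dim : Node m → ℤ
    dim-mono  : ∀ u v → u ⊂ v ≡ true → dim u ℤ.< dim v
    edge-negˡ : ∀ u v → u ⊂ v ≡ true → neg u ⊂ v ≡ true
    edge-negʳ : ∀ u v → u ⊂ v ≡ true → u ⊂ neg v ≡ true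
    sig-negˡ  : ∀ u v → u ⊂ v ≡ true → sig (neg v) u ≡ Sign.opposite (sig v u)
    sig-negʳ  : ∀ u v → u ⊂ v ≡ true → sig v (neg u) ≡ Sign.opposite (sig v u)
    dim-neg   : ∀ u → dim (neg u) ≡ dim u

module _ {m : ℕ} (Γ : DoubleCover m) where
  open DoubleCover Γ

  StronglyGraded : Set
  StronglyGraded = ∀ u v → u ⊂ v ≡ true → dim v ≡ dim u ℤ.+ ℤ.1ℤ

  q : Fin m → Node m
  q i = (i , false)

  -- quotient edge:  i ⊏ j  iff  (a representative of) i ⊂ (a representative of) j
  _⊏_ : Fin m → Fin m → Bool
  i ⊏ j = q i ⊂ q j

  qdim : Fin m → ℤ
  qdim i = dim (q i)

  leafᵇ : Fin m → Bool
  leafᵇ i = not (anyᵇ (λ j → i ⊏ j))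

  rootᵇ : Fin m → Bool
  rootᵇ i = not (anyᵇ (λ t → t ⊏ i))

  IsLP : (Fin m → ℕ) → Set
  IsLP LP = ∀ i → LP i ≡ (if leafᵇ i then 1 else sumℕ (λ j → if i ⊏ j then LP j else 0))

  IsRP : (Fin m → ℕ) → Set
  IsRP RP = ∀ i → RP i ≡ (if rootᵇ i then 1 else sumℕ (λ t → if t ⊏ i then RP t else 0))

  isSign : Sign → Sign → Bool
  isSign s s' = does (s SignP.≟ s')

  module Walks (LP RP : Fin m → ℕ) where

    Pq-up : Fin m → Fin m → ℚ
    Pq-up u u' =
      if leafᵇ u then (if does (u FinP.≟ u') then 1ℚ else 0ℚ)
      else sumℚ (λ v → if (u ⊏ v) ∧ (u' ⊏ v)
                          then (LP v ℕ.* RP u') ÷ℕ (LP u ℕ.* RP v) else 0ℚ)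

    Pq-down : Fin m → Fin m → ℚ
    Pq-down u u' =
      if rootᵇ u then (if does (u FinP.≟ u') then 1ℚ else 0ℚ)
      else sumℚ (λ t → if (t ⊏ u) ∧ (t ⊏ u')
                          then (RP t ℕ.* LP u') ÷ℕ (RP u ℕ.* LP t) else 0ℚ)

    P-up : Node m → Node m → ℚ
    P-up u u' =
      if leafᵇ (proj₁ u) then (if does (proj₁ u FinP.≟ proj₁ u') then ½ else 0ℚ)
      else sumX (λ v → if (u ⊂ v) ∧ (u' ⊂ v) ∧ isSign (sig v u) Sign.+ ∧ isSign (sig v u') Sign.-
                          then (LP (proj₁ v) ℕ.* RP (proj₁ u')) ÷ℕ (LP (proj₁ u) ℕ.* RP (proj₁ v))
                          else 0ℚ)

    P-down : Node m → Node m → ℚ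
    P-down u u' =
      if rootᵇ (proj₁ u) then (if does (proj₁ u FinP.≟ proj₁ u') then ½ else 0ℚ)
      else sumX (λ t → if (t ⊂ u) ∧ (t ⊂ u') ∧ isSign (sig u t) Sign.- ∧ isSign (sig u' t) Sign.+
                          then (RP (proj₁ t) ℕ.* LP (proj₁ u')) ÷ℕ (RP (proj₁ u) ℕ.* LP (proj₁ t))
                          else 0ℚ)

    πq : ℕ → Fin m → ℚ
    πq K i = (LP i ℕ.* RP i) ÷ℕ K

    πX : ℕ → Node m → ℚ
    πX K u = (LP (proj₁ u) ℕ.* RP (proj₁ u)) ÷ℕ (2 ℕ.* K)

  UpAdj : ℤ → Fin m → Fin m → Set
  UpAdj k i j = qdim i ≡ k × qdim j ≡ k × i ≢ j ×
                ∃ λ v → qdim v ≡ k ℤ.+ ℤ.1ℤ × i ⊏ v ≡ true × j ⊏ v ≡ true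

  DownAdj : ℤ → Fin m → Fin m → Set
  DownAdj k i j = qdim i ≡ k × qdim j ≡ k × i ≢ j ×
                  ∃ λ t → qdim t ≡ k ℤ.- ℤ.1ℤ × t ⊏ i ≡ true × t ⊏ j ≡ true

  ConnectedIn : ℤ → (Fin m → Fin m → Set) → (Fin m → Bool) → Set
  ConnectedIn k Adj D =
    (∀ i → D i ≡ true → qdim i ≡ k) ×
    (∀ i j → D i ≡ true → D j ≡ true →
       Star (λ a b → D a ≡ true × D b ≡ true × Adj a b) i j)

  IsComponent : ℤ → (Fin m → Fin m → Set) → (Fin m → Bool) → Set
  IsComponent k Adj C =
    ConnectedIn k Adj C ×
    (∃ λ i → C i ≡ true) ×
    (∀ D → ConnectedIn k Adj D → (∀ i → C i ≡ true → D i ≡ true) →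
       ∀ i → D i ≡ true → C i ≡ true)

  IsUpComponent : ℤ → (Fin m → Bool) → Set
  IsUpComponent k C = IsComponent k (UpAdj k) C

  IsDownComponent : ℤ → (Fin m → Bool) → Set
  IsDownComponent k C = IsComponent k (DownAdj k) C

  ChainFrom : Fin m → List (Fin m) → Set
  ChainFrom w []       = leafᵇ w ≡ true
  ChainFrom w (x ∷ xs) = w ⊏ x ≡ true × ChainFrom x xs

  IsRootLeafPath : List (Fin m) → Set
  IsRootLeafPath []       = ⊥
  IsRootLeafPath (w ∷ ws) = rootᵇ w ≡ true × ChainFrom w ws

  -- ps lists, without repetition, exactly the root-to-leaf paths
  -- containing a node of C; so K = length ps.
  EnumeratesPathsThrough : (Fin m → Bool) → List (List (Fin m)) → Set
  EnumeratesPathsThrough C ps =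
    Unique ps ×
    (∀ p → p ∈ ps → IsRootLeafPath p × Any (λ w → C w ≡ true) p) ×
    (∀ p → IsRootLeafPath p → Any (λ w → C w ≡ true) p → p ∈ ps)

Reversible : {A : Set} → (A → Bool) → (A → ℚ) → (A → A → ℚ) → Set
Reversible S π P = ∀ u u' → S u ≡ true → S u' ≡ true → π u ℚ.* P u u' ≡ π u' ℚ.* P u' u

SumsToOneFin : ∀ {m} → (Fin m → Bool) → (Fin m → ℚ) → Set
SumsToOneFin C π = sumℚ (λ i → if C i then π i else 0ℚ) ≡ 1ℚ

StationaryFin : ∀ {m} → (Fin m → Bool) → (Fin m → ℚ) → (Fin m → Fin m → ℚ) → Set
StationaryFin C π P = ∀ j → C j ≡ true → sumℚ (λ i → if C i then π i ℚ.* P i j else 0ℚ) ≡ π j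

SumsToOneX : ∀ {m} → (Fin m → Bool) → (Node m → ℚ) → Set
SumsToOneX C π = sumX (λ u → if C (proj₁ u) then π u else 0ℚ) ≡ 1ℚ

{-# OPTIONS --safe #-}

-- LP i counts the chains from i up to a leaf and RP i the chains from a root
-- down to i.  All nodes of a component lie in one dimension, so a root-to-leaf path meets
-- the component at most once, and K = Σ_{i ∈ C} LP i · RP i; hence π sums to one.
-- Detailed balance holds term by term: the contribution of v to π u · P(u, u') is
-- RP u · RP u' · LP v / (K · RP v), which is symmetric in u and u'; on the double cover the
-- term for v matches the term for −v with u and u' exchanged, since [−v : u] = −[v : u].
-- Under strong grading an up-component contains all siblings (nodes below a common node)
-- of its nodes, so each row of the quotient walk sums to one over the component
-- (Σ RP over the nodes below v is RP v, Σ LP over the nodes above j is LP j), and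
-- reversibility then gives stationarity.  Reversing all edges turns the down-walks into
-- up-walks and swaps LP with RP, which gives the down statements.

module Submission where

open import Defs
open import Data.Nat using (ℕ)
open import Data.Integer using (ℤ)
open import Data.Fin using (Fin)
open import Data.Bool using (Bool)
open import Data.Product using (_×_; proj₁)
open import Data.List using (List; length)

open import Algebra.Bundles using (AbelianGroup; Ring)
import Algebra.Properties.Group as GroupProperties
import Algebra.Properties.Semiring.Sum as SemiringSum
open import Data.Bool using (true; false; not; _∧_; _∨_; if_then_else_)
import Data.Bool.Properties as BoolP
open import Data.Empty using (⊥-elim)
open import Data.Fin using (zero; suc)
import Data.Fin.Properties as FinP
open import Data.Integer as ℤ using (+_)
import Data.Integer.Properties as ℤP
open import Data.List using ([]; _∷_; _++_; _ʳ++_; reverse; concat; concatMap; map; tabulate; allFin)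
import Data.List.Properties as ListP
open import Data.List.Membership.Propositional using (_∈_; find; lose)
open import Data.List.Membership.Propositional.Properties
  using (>>=-∈↔; ∈-∃++; ∈-++⁻; ∈-++⁺ˡ; ∈-++⁺ʳ; ∈-map⁺; ∈-map⁻; ∈-allFin)
open import Data.List.Relation.Binary.Subset.Propositional using (_⊆_)
open import Data.List.Relation.Unary.All as All using (All; []; _∷_)
open import Data.List.Relation.Unary.All.Properties using (All¬⇒¬Any)
open import Data.List.Relation.Unary.Any using (Any; here; there)
import Data.List.Relation.Unary.Any.Properties as AnyP
open import Data.List.Relation.Unary.Unique.Propositional using (Unique; []; _∷_)
import Data.List.Relation.Unary.Unique.Propositional.Properties as UniqueP
open import Data.Nat as ℕ using (zero; suc; z<s)
import Data.Nat.Properties as ℕP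
open import Data.Nat.Tactic.RingSolver using (solve-∀)
open import Data.Product using (_,_; proj₂; ∃; uncurry)
open import Data.Rational as ℚ using (ℚ; 0ℚ; 1ℚ; fromℚᵘ; toℚᵘ)
import Data.Rational.Properties as ℚP
open import Data.Rational.Unnormalised as ℚᵘ using (mkℚᵘ; *≡*)
import Data.Rational.Unnormalised.Properties as ℚᵘP
import Data.Sign as Sign
open import Data.Sum using (_⊎_; inj₁; inj₂)
open import Function using (_∘_; Inverse; mk⇔)
open import Relation.Binary.Construct.Closure.ReflexiveTransitive as Star using (Star; ε; _◅_; _◅◅_)
open import Relation.Binary.PropositionalEquality
open import Relation.Nullary using (¬_; does; yes; no)
open import Relation.Nullary.Decidable using (dec-true; dec-false)

module ℚSum = SemiringSum (Ring.semiring ℚP.+-*-ring)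
module ℤGroup = GroupProperties (AbelianGroup.group ℤP.+-0-abelianGroup)

fromℚᵘ-+ : ∀ p q → fromℚᵘ p ℚ.+ fromℚᵘ q ≡ fromℚᵘ (p ℚᵘ.+ q)
fromℚᵘ-+ p q = ℚP.toℚᵘ-injective (begin
  toℚᵘ (fromℚᵘ p ℚ.+ fromℚᵘ q)          ≈⟨ ℚP.toℚᵘ-homo-+ (fromℚᵘ p) (fromℚᵘ q) ⟩
  toℚᵘ (fromℚᵘ p) ℚᵘ.+ toℚᵘ (fromℚᵘ q)  ≈⟨ ℚᵘP.+-cong (ℚP.toℚᵘ-fromℚᵘ p) (ℚP.toℚᵘ-fromℚᵘ q) ⟩
  p ℚᵘ.+ q                              ≈⟨ ℚP.toℚᵘ-fromℚᵘ (p ℚᵘ.+ q) ⟨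
  toℚᵘ (fromℚᵘ (p ℚᵘ.+ q))              ∎)
  where open ℚᵘP.≃-Reasoning

fromℚᵘ-* : ∀ p q → fromℚᵘ p ℚ.* fromℚᵘ q ≡ fromℚᵘ (p ℚᵘ.* q)
fromℚᵘ-* p q = ℚP.toℚᵘ-injective (begin
  toℚᵘ (fromℚᵘ p ℚ.* fromℚᵘ q)          ≈⟨ ℚP.toℚᵘ-homo-* (fromℚᵘ p) (fromℚᵘ q) ⟩
  toℚᵘ (fromℚᵘ p) ℚᵘ.* toℚᵘ (fromℚᵘ q)  ≈⟨ ℚᵘP.*-cong (ℚP.toℚᵘ-fromℚᵘ p) (ℚP.toℚᵘ-fromℚᵘ q) ⟩
  p ℚᵘ.* q                              ≈⟨ ℚP.toℚᵘ-fromℚᵘ (p ℚᵘ.* q) ⟨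
  toℚᵘ (fromℚᵘ (p ℚᵘ.* q))              ∎)
  where open ℚᵘP.≃-Reasoning

÷ℕ-cross : ∀ a b {D E} → 0 ℕ.< D → 0 ℕ.< E → a ℕ.* E ≡ b ℕ.* D → a ÷ℕ D ≡ b ÷ℕ E
÷ℕ-cross a b (z<s {d}) (z<s {e}) eq = ℚP.fromℚᵘ-cong {mkℚᵘ (+ a) d} {mkℚᵘ (+ b) e}
  (*≡* (trans (sym (ℤP.pos-* a (suc e))) (trans (cong +_ eq) (ℤP.pos-* b (suc d)))))

0÷ℕ : ∀ D → 0 ÷ℕ D ≡ 0ℚ
0÷ℕ zero    = refl
0÷ℕ (suc d) = ÷ℕ-cross 0 0 {D = suc d} {E = 1} z<s z<s refl

n÷ℕn : ∀ {n} → 0 ℕ.< n → n ÷ℕ n ≡ 1ℚ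
n÷ℕn {n} 0<n = ÷ℕ-cross n 1 0<n z<s (ℕP.*-comm n 1)

÷ℕ-+ : ∀ a b D → a ÷ℕ D ℚ.+ b ÷ℕ D ≡ (a ℕ.+ b) ÷ℕ D
÷ℕ-+ a b zero    = ℚP.+-identityʳ 0ℚ
÷ℕ-+ a b (suc d) = begin
  a ÷ℕ suc d ℚ.+ b ÷ℕ suc d                             ≡⟨ fromℚᵘ-+ (mkℚᵘ (+ a) d) (mkℚᵘ (+ b) d) ⟩
  (+ a ℤ.* + suc d ℤ.+ + b ℤ.* + suc d) ℚ./ (suc d ℕ.* suc d)
    ≡⟨ cong (ℚ._/ (suc d ℕ.* suc d)) numerator ⟩
  (a ℕ.* suc d ℕ.+ b ℕ.* suc d) ÷ℕ (suc d ℕ.* suc d)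
    ≡⟨ ÷ℕ-cross (a ℕ.* suc d ℕ.+ b ℕ.* suc d) (a ℕ.+ b) z<s z<s (eq a b (suc d)) ⟩
  (a ℕ.+ b) ÷ℕ suc d                                    ∎
  where
  open ≡-Reasoning
  numerator : + a ℤ.* + suc d ℤ.+ + b ℤ.* + suc d ≡ + (a ℕ.* suc d ℕ.+ b ℕ.* suc d)
  numerator = trans (sym (cong₂ ℤ._+_ (ℤP.pos-* a (suc d)) (ℤP.pos-* b (suc d))))
                    (sym (ℤP.pos-+ (a ℕ.* suc d) (b ℕ.* suc d)))
  eq : ∀ a b D → (a ℕ.* D ℕ.+ b ℕ.* D) ℕ.* D ≡ (a ℕ.+ b) ℕ.* (D ℕ.* D)
  eq = solve-∀

÷ℕ-* : ∀ a b {D E} → 0 ℕ.< D → 0 ℕ.< E → a ÷ℕ D ℚ.* b ÷ℕ E ≡ (a ℕ.* b) ÷ℕ (D ℕ.* E)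
÷ℕ-* a b (z<s {d}) (z<s {e}) = trans (fromℚᵘ-* (mkℚᵘ (+ a) d) (mkℚᵘ (+ b) e))
  (cong (ℚ._/ (suc d ℕ.* suc e)) (sym (ℤP.pos-* a b)))

÷ℕ-double : ∀ a K → a ÷ℕ (2 ℕ.* K) ℚ.+ a ÷ℕ (2 ℕ.* K) ≡ a ÷ℕ K
÷ℕ-double a zero    = ℚP.+-identityʳ 0ℚ
÷ℕ-double a (suc k) = trans (÷ℕ-+ a a (2 ℕ.* suc k)) (÷ℕ-cross (a ℕ.+ a) a z<s z<s (eq a (suc k)))
  where
  eq : ∀ a K → (a ℕ.+ a) ℕ.* K ≡ a ℕ.* (2 ℕ.* K)
  eq = solve-∀

-- The detailed-balance identity: the factor a (that is, LP u) cancels.  For K = 0 both sides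
-- are 0 because n ÷ℕ 0 = 0.
balance : ∀ K a b c x y → 0 ℕ.< a → 0 ℕ.< y →
          (a ℕ.* b) ÷ℕ K ℚ.* (x ℕ.* c) ÷ℕ (a ℕ.* y) ≡ (b ℕ.* c ℕ.* x) ÷ℕ (K ℕ.* y)
balance zero    a b c x y _   _   = ℚP.*-zeroˡ ((x ℕ.* c) ÷ℕ (a ℕ.* y))
balance (suc k) a b c x y 0<a 0<y =
  trans (÷ℕ-* (a ℕ.* b) (x ℕ.* c) z<s 0<ay)
        (÷ℕ-cross (a ℕ.* b ℕ.* (x ℕ.* c)) (b ℕ.* c ℕ.* x) (ℕP.*-mono-< (z<s {k}) 0<ay) (ℕP.*-mono-< (z<s {k}) 0<y)
                  (eq (suc k) a b c x y))
  where
  0<ay = ℕP.*-mono-< 0<a 0<y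
  eq : ∀ K a b c x y → (a ℕ.* b ℕ.* (x ℕ.* c)) ℕ.* (K ℕ.* y) ≡ (b ℕ.* c ℕ.* x) ℕ.* (K ℕ.* (a ℕ.* y))
  eq = solve-∀

if-÷ℕ : ∀ b x D → (if b then x ÷ℕ D else 0ℚ) ≡ (if b then x else 0) ÷ℕ D
if-÷ℕ true  x D = refl
if-÷ℕ false x D = sym (0÷ℕ D)

*-ifℚ : ∀ x b y → x ℚ.* (if b then y else 0ℚ) ≡ (if b then x ℚ.* y else 0ℚ)
*-ifℚ x true  y = refl
*-ifℚ x false y = ℚP.*-zeroʳ x

*-ifℕ : ∀ x b y → x ℕ.* (if b then y else 0) ≡ (if b then x ℕ.* y else 0)
*-ifℕ x true  y = refl
*-ifℕ x false y = ℕP.*-zeroʳ x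

sumℚ-cong : ∀ {m} {f g : Fin m → ℚ} → (∀ i → f i ≡ g i) → sumℚ f ≡ sumℚ g
sumℚ-cong {zero}  f≗g = refl
sumℚ-cong {suc m} f≗g = cong₂ ℚ._+_ (f≗g zero) (sumℚ-cong (f≗g ∘ suc))

sumℚ≡∑ : ∀ {m} (f : Fin m → ℚ) → sumℚ f ≡ ℚSum.sum f
sumℚ≡∑ {zero}  f = refl
sumℚ≡∑ {suc m} f = cong (f zero ℚ.+_) (sumℚ≡∑ (f ∘ suc))

sumℚ-zero : ∀ {m} {f : Fin m → ℚ} → (∀ i → f i ≡ 0ℚ) → sumℚ f ≡ 0ℚ
sumℚ-zero {zero}  f≗0 = refl
sumℚ-zero {suc m} f≗0 = trans (cong₂ ℚ._+_ (f≗0 zero) (sumℚ-zero (f≗0 ∘ suc))) (ℚP.+-identityʳ 0ℚ)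

sumℚ-single : ∀ {m} (f : Fin m → ℚ) j → (∀ i → j ≢ i → f i ≡ 0ℚ) → sumℚ f ≡ f j
sumℚ-single f zero    f≗0 =
  trans (cong (f zero ℚ.+_) (sumℚ-zero (λ i → f≗0 (suc i) λ ()))) (ℚP.+-identityʳ (f zero))
sumℚ-single f (suc j) f≗0 =
  trans (cong₂ ℚ._+_ (f≗0 zero λ ()) (sumℚ-single (f ∘ suc) j λ i j≢i → f≗0 (suc i) (j≢i ∘ FinP.suc-injective)))
        (ℚP.+-identityˡ (f (suc j)))

*-distribˡ-sumℚ : ∀ {m} x (f : Fin m → ℚ) → x ℚ.* sumℚ f ≡ sumℚ (λ i → x ℚ.* f i)
*-distribˡ-sumℚ x f = begin
  x ℚ.* sumℚ f                ≡⟨ cong (x ℚ.*_) (sumℚ≡∑ f) ⟩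
  x ℚ.* ℚSum.sum f            ≡⟨ ℚSum.*-distribˡ-sum x f ⟩
  ℚSum.sum (λ i → x ℚ.* f i)  ≡⟨ sumℚ≡∑ (λ i → x ℚ.* f i) ⟨
  sumℚ (λ i → x ℚ.* f i)      ∎
  where open ≡-Reasoning

sumℚ-comm : ∀ {m n} (f : Fin m → Fin n → ℚ) → sumℚ (λ i → sumℚ (f i)) ≡ sumℚ (λ j → sumℚ (λ i → f i j))
sumℚ-comm f = begin
  sumℚ (λ i → sumℚ (f i))                  ≡⟨ trans (sumℚ-cong (sumℚ≡∑ ∘ f)) (sumℚ≡∑ (ℚSum.sum ∘ f)) ⟩
  ℚSum.sum (λ i → ℚSum.sum (f i))          ≡⟨ ℚSum.∑-comm f ⟩
  ℚSum.sum (λ j → ℚSum.sum (λ i → f i j))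
    ≡⟨ trans (sumℚ-cong (λ j → sumℚ≡∑ (λ i → f i j))) (sumℚ≡∑ (λ j → ℚSum.sum (λ i → f i j))) ⟨
  sumℚ (λ j → sumℚ (λ i → f i j))          ∎
  where open ≡-Reasoning

sumℚ-÷ℕ : ∀ {m} (f : Fin m → ℕ) D → sumℚ (λ i → f i ÷ℕ D) ≡ sumℕ f ÷ℕ D
sumℚ-÷ℕ {zero}  f D = sym (0÷ℕ D)
sumℚ-÷ℕ {suc m} f D = trans (cong (f zero ÷ℕ D ℚ.+_) (sumℚ-÷ℕ (f ∘ suc) D)) (÷ℕ-+ (f zero) _ D)

sumℕ-cong : ∀ {m} {f g : Fin m → ℕ} → (∀ i → f i ≡ g i) → sumℕ f ≡ sumℕ g
sumℕ-cong {zero}  f≗g = refl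
sumℕ-cong {suc m} f≗g = cong₂ ℕ._+_ (f≗g zero) (sumℕ-cong (f≗g ∘ suc))

*-distribˡ-sumℕ : ∀ {m} x (f : Fin m → ℕ) → x ℕ.* sumℕ f ≡ sumℕ (λ i → x ℕ.* f i)
*-distribˡ-sumℕ {zero}  x f = ℕP.*-zeroʳ x
*-distribˡ-sumℕ {suc m} x f =
  trans (ℕP.*-distribˡ-+ x (f zero) _) (cong (x ℕ.* f zero ℕ.+_) (*-distribˡ-sumℕ x (f ∘ suc)))

term≤sumℕ : ∀ {m} (f : Fin m → ℕ) i → f i ℕ.≤ sumℕ f
term≤sumℕ f zero    = ℕP.m≤m+n (f zero) _
term≤sumℕ f (suc i) = ℕP.≤-trans (term≤sumℕ (f ∘ suc) i) (ℕP.m≤n+m _ (f zero))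

sumX-cong : ∀ {m} {f g : Node m → ℚ} → (∀ v → f v ≡ g v) → sumX f ≡ sumX g
sumX-cong f≗g = sumℚ-cong (λ j → cong₂ ℚ._+_ (f≗g (j , false)) (f≗g (j , true)))

sumX-zero : ∀ {m} {f : Node m → ℚ} → (∀ v → f v ≡ 0ℚ) → sumX f ≡ 0ℚ
sumX-zero f≗0 = sumℚ-zero (λ j → trans (cong₂ ℚ._+_ (f≗0 (j , false)) (f≗0 (j , true))) (ℚP.+-identityʳ 0ℚ))

*-distribˡ-sumX : ∀ {m} x (f : Node m → ℚ) → x ℚ.* sumX f ≡ sumX (λ v → x ℚ.* f v)
*-distribˡ-sumX x f = trans (*-distribˡ-sumℚ x (λ j → f (j , false) ℚ.+ f (j , true)))
                            (sumℚ-cong (λ j → ℚP.*-distribˡ-+ x (f (j , false)) (f (j , true))))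

sumX-neg : ∀ {m} (f : Node m → ℚ) → sumX (f ∘ neg) ≡ sumX f
sumX-neg f = sumℚ-cong (λ j → ℚP.+-comm (f (j , true)) (f (j , false)))

anyᵇ⁺ : ∀ {m} (f : Fin m → Bool) i → f i ≡ true → anyᵇ f ≡ true
anyᵇ⁺ f zero    fi≡true rewrite fi≡true = refl
anyᵇ⁺ f (suc i) fi≡true with f zero
... | true  = refl
... | false = anyᵇ⁺ (f ∘ suc) i fi≡true

anyᵇ⁻ : ∀ {m} (f : Fin m → Bool) → anyᵇ f ≡ true → ∃ λ i → f i ≡ true
anyᵇ⁻ {suc m} f any≡true with f zero in f0≡true
... | true  = zero , f0≡true
... | false = let i , fi≡true = anyᵇ⁻ (f ∘ suc) any≡true in suc i , fi≡true

upperBound : ∀ {m} (f : Fin m → ℤ) → ∃ λ b → ∀ i → f i ℤ.≤ b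
upperBound {zero}  f = ℤ.0ℤ , λ ()
upperBound {suc m} f = f zero ℤ.⊔ b , bound
  where
  b = proj₁ (upperBound (f ∘ suc))
  bound : ∀ i → f i ℤ.≤ f zero ℤ.⊔ b
  bound zero    = ℤP.i≤i⊔j (f zero) b
  bound (suc i) = ℤP.≤-trans (proj₂ (upperBound (f ∘ suc)) i) (ℤP.i≤j⊔i (f zero) b)

∈-concatMap⁺ : ∀ {A B : Set} {f : A → List B} {x y xs} → x ∈ xs → y ∈ f x → y ∈ concatMap f xs
∈-concatMap⁺ x∈xs y∈fx = Inverse.to >>=-∈↔ (_ , x∈xs , y∈fx)

∈-concatMap⁻ : ∀ {A B : Set} {f : A → List B} {y} xs → y ∈ concatMap f xs → ∃ λ x → x ∈ xs × y ∈ f x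
∈-concatMap⁻ xs y∈ = Inverse.from >>=-∈↔ y∈

∈-if⁺ : ∀ {A : Set} {b} {x : A} {xs} → b ≡ true → x ∈ xs → x ∈ (if b then xs else [])
∈-if⁺ refl x∈xs = x∈xs

∈-if⁻ : ∀ {A : Set} b {x : A} {xs} → x ∈ (if b then xs else []) → b ≡ true × x ∈ xs
∈-if⁻ true x∈xs = refl , x∈xs

concatMap-unique : ∀ {A B : Set} {f : A → List B} {xs} → Unique xs → (∀ {x} → x ∈ xs → Unique (f x)) →
                   (∀ {x x' y} → x ∈ xs → x' ∈ xs → y ∈ f x → y ∈ f x' → x ≡ x') →
                   Unique (concatMap f xs)
concatMap-unique {xs = []}     []            f-unique f-disjoint = []
concatMap-unique {xs = x ∷ xs} (x∉xs ∷ uxs) f-unique f-disjoint =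
  UniqueP.++⁺ (f-unique (here refl)) (concatMap-unique uxs (f-unique ∘ there) λ p q → f-disjoint (there p) (there q))
    λ (y∈fx , y∈rest) → let x' , x'∈xs , y∈fx' = ∈-concatMap⁻ xs y∈rest
                        in All.lookup x∉xs x'∈xs (f-disjoint (here refl) (there x'∈xs) y∈fx y∈fx')

length-concatMap-allFin : ∀ {B : Set} {m} (f : Fin m → List B) →
                          length (concatMap f (allFin m)) ≡ sumℕ (λ i → length (f i))
length-concatMap-allFin f = trans (cong (length ∘ concat) (ListP.map-tabulate (λ i → i) f)) (length-concat-tabulate f)
  where
  length-concat-tabulate : ∀ {B : Set} {m} (h : Fin m → List B) → length (concat (tabulate h)) ≡ sumℕ (length ∘ h)
  length-concat-tabulate {m = zero}  h = refl
  length-concat-tabulate {m = suc m} h =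
    trans (ListP.length-++ (h zero)) (cong (length (h zero) ℕ.+_) (length-concat-tabulate (h ∘ suc)))

length-concatMap-map : ∀ {A B C : Set} (g : A → B → C) ys (xs : List A) →
                       length (concatMap (λ x → map (g x) ys) xs) ≡ length xs ℕ.* length ys
length-concatMap-map g ys []       = refl
length-concatMap-map g ys (x ∷ xs) =
  trans (ListP.length-++ (map (g x) ys)) (cong₂ ℕ._+_ (ListP.length-map (g x) ys) (length-concatMap-map g ys xs))

Unique-⊆⇒length≤ : ∀ {A : Set} {xs ys : List A} → Unique xs → xs ⊆ ys → length xs ℕ.≤ length ys
Unique-⊆⇒length≤ {xs = []}     _             _     = ℕ.z≤n
Unique-⊆⇒length≤ {xs = x ∷ xs} (x∉xs ∷ uxs) xs⊆ys with as , bs , refl ← ∈-∃++ (xs⊆ys (here refl)) =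
  ℕP.≤-trans (ℕ.s≤s (Unique-⊆⇒length≤ uxs λ z∈xs → drop-x (xs⊆ys (there z∈xs)) (All.lookup x∉xs z∈xs ∘ sym)))
             (ℕP.≤-reflexive (sym (ListP.length-++-sucʳ as x bs)))
  where
  drop-x : ∀ {z} → z ∈ as ++ x ∷ bs → z ≢ x → z ∈ as ++ bs
  drop-x z∈ z≢x with ∈-++⁻ as z∈
  ... | inj₁ z∈as         = ∈-++⁺ˡ z∈as
  ... | inj₂ (here z≡x)   = ⊥-elim (z≢x z≡x)
  ... | inj₂ (there z∈bs) = ∈-++⁺ʳ as z∈bs

firstSplit-unique : ∀ {A : Set} (P : A → Set) xs xs' {x x' : A} {ys ys'} → ¬ Any P xs → ¬ Any P xs' → P x → P x' →
                    xs ++ x ∷ ys ≡ xs' ++ x' ∷ ys' → xs ≡ xs' × x ≡ x' × ys ≡ ys'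
firstSplit-unique P []       []         _    _     _  _   refl = refl , refl , refl
firstSplit-unique P []       (_ ∷ _)    _    ¬Pxs' px _   refl = ⊥-elim (¬Pxs' (here px))
firstSplit-unique P (_ ∷ _)  []         ¬Pxs _     _  px' refl = ⊥-elim (¬Pxs (here px'))
firstSplit-unique P (y ∷ xs) (y' ∷ xs') ¬Pxs ¬Pxs' px px' eq
  with refl , eq′ ← ListP.∷-injective eq
  with refl , refl , refl ← firstSplit-unique P xs xs' (¬Pxs ∘ there) (¬Pxs' ∘ there) px px' eq′ = refl , refl , refl

ʳ++-cancelˡ : ∀ {A : Set} (r : List A) {ys zs} → r ʳ++ ys ≡ r ʳ++ zs → ys ≡ zs
ʳ++-cancelˡ []      eq = eq
ʳ++-cancelˡ (x ∷ r) eq = ListP.∷-injectiveʳ (ʳ++-cancelˡ r eq)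

dual : ∀ {m} → DoubleCover m → DoubleCover m
dual Γ = record
  { _⊂_       = λ u v → v ⊂ u
  ; sig       = λ v u → Sign.opposite (sig u v)
  ; dim       = λ u → ℤ.- dim u
  ; dim-mono  = λ u v v⊂u → ℤP.neg-mono-< (dim-mono v u v⊂u)
  ; edge-negˡ = λ u v v⊂u → edge-negʳ v u v⊂u
  ; edge-negʳ = λ u v v⊂u → edge-negˡ v u v⊂u
  ; sig-negˡ  = λ u v v⊂u → cong Sign.opposite (sig-negʳ v u v⊂u)
  ; sig-negʳ  = λ u v v⊂u → cong Sign.opposite (sig-negˡ v u v⊂u)
  ; dim-neg   = λ u → cong ℤ.-_ (dim-neg u)
  }
  where open DoubleCover Γ

isSign-opposite : ∀ {m} (Γ : DoubleCover m) s t → isSign Γ (Sign.opposite s) (Sign.opposite t) ≡ isSign Γ s t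
isSign-opposite Γ Sign.- Sign.- = refl
isSign-opposite Γ Sign.- Sign.+ = refl
isSign-opposite Γ Sign.+ Sign.- = refl
isSign-opposite Γ Sign.+ Sign.+ = refl

module Graph {m} (Γ : DoubleCover m) where
  open DoubleCover Γ

  infix 5 _⋖_
  _⋖_ : Fin m → Fin m → Bool
  _⋖_ = _⊏_ Γ

  ⋖⇒nonLeaf : ∀ {i j} → i ⋖ j ≡ true → leafᵇ Γ i ≡ false
  ⋖⇒nonLeaf {i} {j} i⋖j = cong not (anyᵇ⁺ (i ⋖_) j i⋖j)

  ⋖⇒nonRoot : ∀ {t v} → t ⋖ v ≡ true → rootᵇ Γ v ≡ false
  ⋖⇒nonRoot {t} {v} t⋖v = cong not (anyᵇ⁺ (_⋖ v) t t⋖v)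

  leaf-⋖ : ∀ {i j} → leafᵇ Γ i ≡ true → i ⋖ j ≡ false
  leaf-⋖ {i} {j} leaf with i ⋖ j in i⋖j
  ... | false = refl
  ... | true  with () ← trans (sym leaf) (⋖⇒nonLeaf i⋖j)

  nonLeaf-⋖ : ∀ {i} → leafᵇ Γ i ≡ false → ∃ λ j → i ⋖ j ≡ true
  nonLeaf-⋖ {i} nonLeaf = anyᵇ⁻ (i ⋖_) (BoolP.not-injective nonLeaf)

  neg-involutive : ∀ (u : Node m) → neg (neg u) ≡ u
  neg-involutive (i , b) = cong (i ,_) (BoolP.not-involutive b)

  ⊂-negˡ : ∀ u v → neg u ⊂ v ≡ u ⊂ v
  ⊂-negˡ u v = BoolP.⇔→≡ {z = true}
    (mk⇔ (subst (λ w → w ⊂ v ≡ true) (neg-involutive u) ∘ edge-negˡ (neg u) v) (edge-negˡ u v))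

  ⊂-negʳ : ∀ u v → u ⊂ neg v ≡ u ⊂ v
  ⊂-negʳ u v = BoolP.⇔→≡ {z = true}
    (mk⇔ (subst (λ w → u ⊂ w ≡ true) (neg-involutive v) ∘ edge-negʳ u (neg v)) (edge-negʳ u v))

  ⊂≡⋖ : ∀ i b j c → (i , b) ⊂ (j , c) ≡ i ⋖ j
  ⊂≡⋖ i false j false = refl
  ⊂≡⋖ i false j true  = ⊂-negʳ (i , false) (j , false)
  ⊂≡⋖ i true  j false = ⊂-negˡ (i , false) (j , false)
  ⊂≡⋖ i true  j true  = trans (⊂-negˡ (i , false) (j , true)) (⊂-negʳ (i , false) (j , false))

  private
    top : ℤ
    top = proj₁ (upperBound (qdim Γ))

    ≤top : ∀ i → qdim Γ i ℤ.≤ top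
    ≤top = proj₂ (upperBound (qdim Γ))

  -- The distance to the top dimension bounds the length of every chain starting at a node.
  depth : Fin m → ℕ
  depth i = ℤ.∣ qdim Γ i ℤ.- top ∣

  depth-⋖ : ∀ {i j} → i ⋖ j ≡ true → depth j ℕ.< depth i
  depth-⋖ {i} {j} i⋖j = ℤP.drop‿+<+ (subst₂ ℤ._<_ (sym (ℤP.∣-∣-≤ (≤top j))) (sym (ℤP.∣-∣-≤ (≤top i)))
                                        (ℤP.+-monoʳ-< top (ℤP.neg-mono-< (dim-mono (q Γ i) (q Γ j) i⋖j))))

  depth-⋖-fuel : ∀ {n i j} → depth i ℕ.< suc n → i ⋖ j ≡ true → depth j ℕ.< n
  depth-⋖-fuel d<1+n i⋖j = ℕP.<-≤-trans (depth-⋖ i⋖j) (ℕP.≤-pred d<1+n)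

  ChainFrom-dims : ∀ {i} s → ChainFrom Γ i s → All (λ w → qdim Γ i ℤ.< qdim Γ w) s
  ChainFrom-dims []      _             = []
  ChainFrom-dims (j ∷ s) (i⋖j , chain) = i<j ∷ All.map (ℤP.<-trans i<j) (ChainFrom-dims s chain)
    where i<j = dim-mono (q Γ _) (q Γ j) i⋖j

  -- chains n i lists the chains from i to a leaf as soon as the fuel n exceeds depth i.
  chains : ℕ → Fin m → List (List (Fin m))
  chains zero    i = []
  chains (suc n) i = if leafᵇ Γ i then [] ∷ []
                     else concatMap (λ j → if i ⋖ j then map (j ∷_) (chains n j) else []) (allFin m)

  chains-sound : ∀ n i {s} → s ∈ chains n i → ChainFrom Γ i s
  chains-sound (suc n) i s∈ with leafᵇ Γ i in leaf
  ... | true  with s∈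
  ...   | here refl = leaf
  chains-sound (suc n) i s∈ | false
    with j , _ , s∈ext ← ∈-concatMap⁻ (allFin m) s∈
    with i⋖j , s∈map ← ∈-if⁻ (i ⋖ j) s∈ext
    with t , t∈ , refl ← ∈-map⁻ (j ∷_) s∈map = i⋖j , chains-sound n j t∈

  chains-complete : ∀ n i {s} → depth i ℕ.< n → ChainFrom Γ i s → s ∈ chains n i
  chains-complete (suc n) i {[]}    _  leaf rewrite leaf = here refl
  chains-complete (suc n) i {j ∷ t} d< (i⋖j , chain) rewrite ⋖⇒nonLeaf i⋖j =
    ∈-concatMap⁺ (∈-allFin j) (∈-if⁺ i⋖j (∈-map⁺ (j ∷_) (chains-complete n j (depth-⋖-fuel d< i⋖j) chain)))

  chains-unique : ∀ n i → Unique (chains n i)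
  chains-unique zero    i = []
  chains-unique (suc n) i with leafᵇ Γ i
  ... | true  = [] ∷ []
  ... | false = concatMap-unique (UniqueP.allFin⁺ m) (λ {j} _ → extension-unique j) extensions-disjoint
    where
    extension : Fin m → List (List (Fin m))
    extension j = if i ⋖ j then map (j ∷_) (chains n j) else []

    extension-unique : ∀ j → Unique (extension j)
    extension-unique j with i ⋖ j
    ... | true  = UniqueP.map⁺ ListP.∷-injectiveʳ (chains-unique n j)
    ... | false = []

    head-of-extension : ∀ {j s} → s ∈ extension j → ∃ λ t → s ≡ j ∷ t
    head-of-extension {j} s∈ with _ , s∈map ← ∈-if⁻ (i ⋖ j) s∈ with t , _ , s≡ ← ∈-map⁻ (j ∷_) s∈map = t , s≡

    extensions-disjoint : ∀ {j j' s} → j ∈ allFin m → j' ∈ allFin m → s ∈ extension j → s ∈ extension j' → j ≡ j'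
    extensions-disjoint _ _ s∈ s∈' with _ , refl ← head-of-extension s∈ with _ , refl ← head-of-extension s∈' = refl

  chainsFrom : Fin m → List (List (Fin m))
  chainsFrom i = chains (suc (depth i)) i

  chainsFrom-sound : ∀ {i s} → s ∈ chainsFrom i → ChainFrom Γ i s
  chainsFrom-sound {i} = chains-sound (suc (depth i)) i

  chainsFrom-complete : ∀ {i s} → ChainFrom Γ i s → s ∈ chainsFrom i
  chainsFrom-complete {i} = chains-complete (suc (depth i)) i ℕP.≤-refl

  chainsFrom-unique : ∀ i → Unique (chainsFrom i)
  chainsFrom-unique i = chains-unique (suc (depth i)) i

  module _ (LP : Fin m → ℕ) (isLP : IsLP Γ LP) where

    LP-leaf : ∀ {i} → leafᵇ Γ i ≡ true → LP i ≡ 1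
    LP-leaf {i} leaf = trans (isLP i) (cong (if_then 1 else sumℕ (λ j → if i ⋖ j then LP j else 0)) leaf)

    LP-nonLeaf : ∀ {i} → leafᵇ Γ i ≡ false → LP i ≡ sumℕ (λ j → if i ⋖ j then LP j else 0)
    LP-nonLeaf {i} nonLeaf = trans (isLP i) (cong (if_then 1 else sumℕ (λ j → if i ⋖ j then LP j else 0)) nonLeaf)

    LP-positive : ∀ i → 0 ℕ.< LP i
    LP-positive i = positive (suc (depth i)) i ℕP.≤-refl
      where
      positive : ∀ n i → depth i ℕ.< n → 0 ℕ.< LP i
      positive (suc n) i d< with leafᵇ Γ i in leaf
      ... | true  = subst (0 ℕ.<_) (sym (LP-leaf leaf)) z<s
      ... | false = let j , i⋖j = nonLeaf-⋖ leaf in ℕP.<-≤-trans (positive n j (depth-⋖-fuel d< i⋖j)) (begin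
        LP j                                      ≡⟨ cong (if_then LP j else 0) i⋖j ⟨
        (if i ⋖ j then LP j else 0)               ≤⟨ term≤sumℕ (λ j → if i ⋖ j then LP j else 0) j ⟩
        sumℕ (λ j → if i ⋖ j then LP j else 0)    ≡⟨ LP-nonLeaf leaf ⟨
        LP i                                      ∎)
        where open ℕP.≤-Reasoning

    length-chains : ∀ n i → depth i ℕ.< n → length (chains n i) ≡ LP i
    length-chains (suc n) i d< with leafᵇ Γ i in leaf
    ... | true  = sym (LP-leaf leaf)
    ... | false = begin
      length (concatMap extension (allFin m))   ≡⟨ length-concatMap-allFin extension ⟩
      sumℕ (λ j → length (extension j))         ≡⟨ sumℕ-cong length-extension ⟩
      sumℕ (λ j → if i ⋖ j then LP j else 0)    ≡⟨ LP-nonLeaf leaf ⟨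
      LP i                                      ∎
      where
      open ≡-Reasoning
      extension : Fin m → List (List (Fin m))
      extension j = if i ⋖ j then map (j ∷_) (chains n j) else []

      length-extension : ∀ j → length (extension j) ≡ (if i ⋖ j then LP j else 0)
      length-extension j with i ⋖ j in i⋖j
      ... | true  = trans (ListP.length-map (j ∷_) (chains n j)) (length-chains n j (depth-⋖-fuel d< i⋖j))
      ... | false = refl

    length-chainsFrom : ∀ i → length (chainsFrom i) ≡ LP i
    length-chainsFrom i = length-chains (suc (depth i)) i ℕP.≤-refl

-- r is a chain from i down to a root, so it enters the path reversed.
glue : ∀ {m} → Fin m → List (Fin m) → List (Fin m) → List (Fin m)
glue i r s = r ʳ++ i ∷ s

module _ {m} (Γ : DoubleCover m) where

  rootLeafPath-split⁻ : ∀ r i s → IsRootLeafPath Γ (glue i r s) → ChainFrom (dual Γ) i r × ChainFrom Γ i s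
  rootLeafPath-split⁻ []      i s path = path
  rootLeafPath-split⁻ (t ∷ r) i s path =
    let down , (t⋖i , up) = rootLeafPath-split⁻ r t (i ∷ s) path in (t⋖i , down) , up

  rootLeafPath-split⁺ : ∀ r i s → ChainFrom (dual Γ) i r → ChainFrom Γ i s → IsRootLeafPath Γ (glue i r s)
  rootLeafPath-split⁺ []      i s root           up = root , up
  rootLeafPath-split⁺ (t ∷ r) i s (t⋖i , down) up = rootLeafPath-split⁺ r t (i ∷ s) down (t⋖i , up)

module PathCount {m} (Γ : DoubleCover m) (LP RP : Fin m → ℕ) (isLP : IsLP Γ LP) (isRP : IsRP Γ RP) where
  module ↑ = Graph Γ
  module ↓ = Graph (dual Γ)

  pathsThrough : Fin m → List (List (Fin m))
  pathsThrough i = concatMap (λ r → map (glue i r) (↑.chainsFrom i)) (↓.chainsFrom i)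

  ∈-pathsThrough⁻ : ∀ {i p} → p ∈ pathsThrough i →
                    ∃ λ r → ∃ λ s → r ∈ ↓.chainsFrom i × s ∈ ↑.chainsFrom i × p ≡ glue i r s
  ∈-pathsThrough⁻ {i} p∈ with r , r∈ , p∈′ ← ∈-concatMap⁻ (↓.chainsFrom i) p∈
                         with s , s∈ , p≡ ← ∈-map⁻ (glue i r) p∈′ = r , s , r∈ , s∈ , p≡

  length-pathsThrough : ∀ i → length (pathsThrough i) ≡ LP i ℕ.* RP i
  length-pathsThrough i = begin
    length (pathsThrough i)
      ≡⟨ length-concatMap-map (glue i) (↑.chainsFrom i) (↓.chainsFrom i) ⟩
    length (↓.chainsFrom i) ℕ.* length (↑.chainsFrom i)
      ≡⟨ cong₂ ℕ._*_ (↓.length-chainsFrom RP isRP i) (↑.length-chainsFrom LP isLP i) ⟩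
    RP i ℕ.* LP i
      ≡⟨ ℕP.*-comm (RP i) (LP i) ⟩
    LP i ℕ.* RP i
      ∎
    where open ≡-Reasoning

  module _ (k : ℤ) (C : Fin m → Bool) (C-level : ∀ i → C i ≡ true → qdim Γ i ≡ k) where

    pathsThroughC : List (List (Fin m))
    pathsThroughC = concatMap (λ i → if C i then pathsThrough i else []) (allFin m)

    length-pathsThroughC : length pathsThroughC ≡ sumℕ (λ i → if C i then LP i ℕ.* RP i else 0)
    length-pathsThroughC =
      trans (length-concatMap-allFin (λ i → if C i then pathsThrough i else [])) (sumℕ-cong length-restricted)
      where
      length-restricted : ∀ i → length (if C i then pathsThrough i else []) ≡ (if C i then LP i ℕ.* RP i else 0)
      length-restricted i with C i
      ... | true  = length-pathsThrough i
      ... | false = refl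

    -- The nodes of a chain below a node of C lie strictly below dimension k, so a path
    -- through C determines its node in C and the two chains around it.
    below-level : ∀ {i r} → C i ≡ true → r ∈ ↓.chainsFrom i → ¬ Any (λ w → qdim Γ w ≡ k) (reverse r)
    below-level {i} {r} Ci r∈ =
      All¬⇒¬Any (All.map (λ below w≡k → ℤP.<-irrefl (cong ℤ.-_ (trans (C-level i Ci) (sym w≡k))) below)
                         (↓.ChainFrom-dims r (↓.chainsFrom-sound r∈)))
      ∘ AnyP.reverse⁻

    glue-injective : ∀ {i i' r r' s s'} → C i ≡ true → C i' ≡ true → r ∈ ↓.chainsFrom i → r' ∈ ↓.chainsFrom i' →
                     glue i r s ≡ glue i' r' s' → i ≡ i' × r ≡ r' × s ≡ s'
    glue-injective {i} {i'} {r} {r'} Ci Ci' r∈ r'∈ eq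
      with r≡r' , refl , refl ← firstSplit-unique (λ w → qdim Γ w ≡ k) (reverse r) (reverse r')
                                   (below-level Ci r∈) (below-level Ci' r'∈) (C-level i Ci) (C-level i' Ci')
                                   (trans (sym (ListP.ʳ++-defn r)) (trans eq (ListP.ʳ++-defn r')))
      = refl , ListP.reverse-injective r≡r' , refl

    pathsThroughC-unique : Unique pathsThroughC
    pathsThroughC-unique = concatMap-unique (UniqueP.allFin⁺ m) (λ {i} _ → restricted-unique i) restricted-disjoint
      where
      pathsThrough-unique : ∀ {i} → C i ≡ true → Unique (pathsThrough i)
      pathsThrough-unique {i} Ci = concatMap-unique (↓.chainsFrom-unique i)
        (λ {r} _ → UniqueP.map⁺ (ListP.∷-injectiveʳ ∘ ʳ++-cancelˡ r) (↑.chainsFrom-unique i))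
        λ r∈ r'∈ p∈ p∈' → let _ , _ , p≡ = ∈-map⁻ _ p∈; _ , _ , p≡' = ∈-map⁻ _ p∈'
                          in proj₁ (proj₂ (glue-injective Ci Ci r∈ r'∈ (trans (sym p≡) p≡')))

      restricted-unique : ∀ i → Unique (if C i then pathsThrough i else [])
      restricted-unique i with C i in Ci
      ... | true  = pathsThrough-unique Ci
      ... | false = []

      restricted-disjoint : ∀ {i i' p} → i ∈ allFin m → i' ∈ allFin m →
                            p ∈ (if C i then pathsThrough i else []) → p ∈ (if C i' then pathsThrough i' else []) →
                            i ≡ i'
      restricted-disjoint {i} {i'} _ _ p∈ p∈'
        with Ci  , p∈₁ ← ∈-if⁻ (C i) p∈   with _ , _ , r∈  , _ , p≡  ← ∈-pathsThrough⁻ p∈₁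
        with Ci' , p∈₂ ← ∈-if⁻ (C i') p∈' with _ , _ , r'∈ , _ , p≡' ← ∈-pathsThrough⁻ p∈₂
        = proj₁ (glue-injective Ci Ci' r∈ r'∈ (trans (sym p≡) p≡'))

    ∈-pathsThroughC⁺ : ∀ {p} → IsRootLeafPath Γ p → Any (λ w → C w ≡ true) p → p ∈ pathsThroughC
    ∈-pathsThroughC⁺ path throughC
      with w , w∈p , Cw ← find throughC
      with xs , ys , refl ← ∈-∃++ w∈p
      = subst (_∈ pathsThroughC) p≡
          (∈-concatMap⁺ (∈-allFin w) (∈-if⁺ Cw (∈-concatMap⁺ (↓.chainsFrom-complete (proj₁ split))
                                                              (∈-map⁺ (glue w r) (↑.chainsFrom-complete (proj₂ split))))))
      where
      r = reverse xs
      p≡ : glue w r ys ≡ xs ++ w ∷ ys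
      p≡ = trans (ListP.ʳ++-defn r) (cong (_++ w ∷ ys) (ListP.reverse-involutive xs))
      split = rootLeafPath-split⁻ Γ r w ys (subst (IsRootLeafPath Γ) (sym p≡) path)

    ∈-pathsThroughC⁻ : ∀ {p} → p ∈ pathsThroughC → IsRootLeafPath Γ p × Any (λ w → C w ≡ true) p
    ∈-pathsThroughC⁻ p∈
      with i , _ , p∈′ ← ∈-concatMap⁻ (allFin m) p∈
      with Ci , p∈ᵢ ← ∈-if⁻ (C i) p∈′
      with r , s , r∈ , s∈ , refl ← ∈-pathsThrough⁻ p∈ᵢ
      = rootLeafPath-split⁺ Γ r i s (↓.chainsFrom-sound r∈) (↑.chainsFrom-sound s∈) , lose i∈glue Ci
      where
      i∈glue : i ∈ glue i r s
      i∈glue = subst (i ∈_) (sym (ListP.ʳ++-defn r)) (∈-++⁺ʳ (reverse r) (here refl))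

    pathCount : ∀ {ps} → EnumeratesPathsThrough Γ C ps → length ps ≡ sumℕ (λ i → if C i then LP i ℕ.* RP i else 0)
    pathCount (ps-unique , ps-sound , ps-complete) = trans
      (ℕP.≤-antisym (Unique-⊆⇒length≤ ps-unique λ p∈ → uncurry ∈-pathsThroughC⁺ (ps-sound _ p∈))
                    (Unique-⊆⇒length≤ pathsThroughC-unique λ p∈ → uncurry (ps-complete _) (∈-pathsThroughC⁻ p∈)))
      length-pathsThroughC

SiblingClosed : ∀ {m} → DoubleCover m → (Fin m → Bool) → Set
SiblingClosed Γ C = ∀ {j i v} → C j ≡ true → j ⋖ v ≡ true → i ⋖ v ≡ true → C i ≡ true
  where open Graph Γ using (_⋖_)

module _ {m} (Γ : DoubleCover m) where

  private
    addNode : (Fin m → Bool) → Fin m → Fin m → Bool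
    addNode C i x = C x ∨ does (x FinP.≟ i)

    addNode-old : ∀ C i {x} → C x ≡ true → addNode C i x ≡ true
    addNode-old C i Cx rewrite Cx = refl

    addNode-new : ∀ C i → addNode C i i ≡ true
    addNode-new C i = trans (cong (C i ∨_) (dec-true (i FinP.≟ i) refl)) (BoolP.∨-zeroʳ (C i))

    addNode⁻ : ∀ C i x → addNode C i x ≡ true → C x ≡ true ⊎ x ≡ i
    addNode⁻ C i x _ with C x | x FinP.≟ i
    ... | true  | _        = inj₁ refl
    ... | false | yes x≡i = inj₂ x≡i

  module _ {k : ℤ} {Adj : Fin m → Fin m → Set} where

    addNode-connected : ∀ {C j i} → ConnectedIn Γ k Adj C → C j ≡ true → qdim Γ i ≡ k → Adj j i → Adj i j →
                        ConnectedIn Γ k Adj (addNode C i)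
    addNode-connected {C} {j} {i} (C-level , C-paths) Cj i-level j→i i→j = D-level , D-paths
      where
      D = addNode C i
      Edge : (Fin m → Bool) → Fin m → Fin m → Set
      Edge S a b = S a ≡ true × S b ≡ true × Adj a b

      liftPath : ∀ {x y} → Star (Edge C) x y → Star (Edge D) x y
      liftPath = Star.map λ (Ca , Cb , a→b) → addNode-old C i Ca , addNode-old C i Cb , a→b

      D-level : ∀ x → D x ≡ true → qdim Γ x ≡ k
      D-level x Dx with addNode⁻ C i x Dx
      ... | inj₁ Cx   = C-level x Cx
      ... | inj₂ refl = i-level

      D-paths : ∀ x y → D x ≡ true → D y ≡ true → Star (Edge D) x y
      D-paths x y Dx Dy with addNode⁻ C i x Dx | addNode⁻ C i y Dy
      ... | inj₁ Cx   | inj₁ Cy   = liftPath (C-paths x y Cx Cy)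
      ... | inj₁ Cx   | inj₂ refl = liftPath (C-paths x j Cx Cj) ◅◅ ((addNode-old C i Cj , addNode-new C i , j→i) ◅ ε)
      ... | inj₂ refl | inj₁ Cy   = (addNode-new C i , addNode-old C i Cj , i→j) ◅ liftPath (C-paths j y Cj Cy)
      ... | inj₂ refl | inj₂ refl = ε

    component-absorbs : ∀ {C j i} → IsComponent Γ k Adj C → C j ≡ true → qdim Γ i ≡ k →
                        (j ≢ i → Adj j i) → (j ≢ i → Adj i j) → C i ≡ true
    component-absorbs {C} {j} {i} (connected , _ , maximal) Cj i-level j→i i→j with j FinP.≟ i
    ... | yes refl = Cj
    ... | no  j≢i  = maximal (addNode C i) (addNode-connected connected Cj i-level (j→i j≢i) (i→j j≢i))
                             (λ _ → addNode-old C i) i (addNode-new C i)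

  upComponent-siblingClosed : StronglyGraded Γ → ∀ {k C} → IsUpComponent Γ k C → SiblingClosed Γ C
  upComponent-siblingClosed graded {k} component {j} {i} {v} Cj j⋖v i⋖v =
    component-absorbs component Cj i-level (λ j≢i → j-level , i-level , j≢i , v , v-level , j⋖v , i⋖v)
                                           (λ j≢i → i-level , j-level , j≢i ∘ sym , v , v-level , i⋖v , j⋖v)
    where
    j-level : qdim Γ j ≡ k
    j-level = proj₁ (proj₁ component) j Cj
    v-level : qdim Γ v ≡ k ℤ.+ ℤ.1ℤ
    v-level = trans (graded _ _ j⋖v) (cong (ℤ._+ ℤ.1ℤ) j-level)
    i-level : qdim Γ i ≡ k
    i-level = trans (ℤGroup.∙-cancelʳ ℤ.1ℤ _ _ (trans (sym (graded _ _ i⋖v)) (graded _ _ j⋖v))) j-level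

  downComponent-siblingClosed : StronglyGraded Γ → ∀ {k C} → IsDownComponent Γ k C → SiblingClosed (dual Γ) C
  downComponent-siblingClosed graded {k} component {j} {i} {t} Cj t⋖j t⋖i =
    component-absorbs component Cj i-level (λ j≢i → j-level , i-level , j≢i , t , t-level , t⋖j , t⋖i)
                                           (λ j≢i → i-level , j-level , j≢i ∘ sym , t , t-level , t⋖i , t⋖j)
    where
    j-level : qdim Γ j ≡ k
    j-level = proj₁ (proj₁ component) j Cj
    t-level : qdim Γ t ≡ k ℤ.- ℤ.1ℤ
    t-level = ℤGroup.x≈z//y (qdim Γ t) ℤ.1ℤ k (trans (sym (graded _ _ t⋖j)) j-level)
    i-level : qdim Γ i ≡ k
    i-level = trans (graded _ _ t⋖i) (trans (sym (graded _ _ t⋖j)) j-level)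

DetailedBalance : {A : Set} → (A → ℚ) → (A → A → ℚ) → Set
DetailedBalance π P = ∀ u u' → π u ℚ.* P u u' ≡ π u' ℚ.* P u' u

detailedBalance-resp : ∀ {A : Set} {π π' : A → ℚ} {P P' : A → A → ℚ} →
                       (∀ u → π u ≡ π' u) → (∀ u u' → P u u' ≡ P' u u') → DetailedBalance π' P' → DetailedBalance π P
detailedBalance-resp π≗π' P≗P' balanced u u' =
  trans (cong₂ ℚ._*_ (π≗π' u) (P≗P' u u')) (trans (balanced u u') (sym (cong₂ ℚ._*_ (π≗π' u') (P≗P' u' u))))

reversible⇒stationary : ∀ {m} (C : Fin m → Bool) π P → Reversible C π P →
                        (∀ j → C j ≡ true → sumℚ (λ i → if C i then P j i else 0ℚ) ≡ 1ℚ) → StationaryFin C π P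
reversible⇒stationary C π P reversible rowSum j Cj = begin
  sumℚ (λ i → if C i then π i ℚ.* P i j else 0ℚ)    ≡⟨ sumℚ-cong flow ⟩
  sumℚ (λ i → π j ℚ.* (if C i then P j i else 0ℚ))  ≡⟨ *-distribˡ-sumℚ (π j) (λ i → if C i then P j i else 0ℚ) ⟨
  π j ℚ.* sumℚ (λ i → if C i then P j i else 0ℚ)    ≡⟨ cong (π j ℚ.*_) (rowSum j Cj) ⟩
  π j ℚ.* 1ℚ                                        ≡⟨ ℚP.*-identityʳ (π j) ⟩
  π j                                               ∎
  where
  open ≡-Reasoning
  flow : ∀ i → (if C i then π i ℚ.* P i j else 0ℚ) ≡ π j ℚ.* (if C i then P j i else 0ℚ)
  flow i with C i in Ci
  ... | true  = reversible i j Ci Cj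
  ... | false = sym (ℚP.*-zeroʳ (π j))

module _ {m} {A : Set} (f : A → Fin m) (isLeaf : Fin m → Bool) (c : ℚ) where

  -- Both up-walks have this shape: f = id and c = 1 on the quotient, f = proj₁ and c = ½ on the cover.
  HoldAtLeaves : (A → A → ℚ) → A → A → ℚ
  HoldAtLeaves S u u' = if isLeaf (f u) then (if does (f u FinP.≟ f u') then c else 0ℚ) else S u u'

  private
    hold-balanced : ∀ (π : Fin m → ℚ) i i' →
                    π i ℚ.* (if does (i FinP.≟ i') then c else 0ℚ) ≡ π i' ℚ.* (if does (i' FinP.≟ i) then c else 0ℚ)
    hold-balanced π i i' with i FinP.≟ i' | i' FinP.≟ i
    ... | yes refl | yes _    = refl
    ... | yes refl | no i≢i   = ⊥-elim (i≢i refl)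
    ... | no i≢i   | yes refl = ⊥-elim (i≢i refl)
    ... | no _     | no _     = trans (ℚP.*-zeroʳ (π i)) (sym (ℚP.*-zeroʳ (π i')))

    leaf-to-nonLeaf : ∀ (π : Fin m → ℚ) (S : A → A → ℚ) → (∀ u u' → isLeaf (f u') ≡ true → S u u' ≡ 0ℚ) →
                      ∀ u u' → isLeaf (f u) ≡ true → isLeaf (f u') ≡ false →
                      π (f u) ℚ.* (if does (f u FinP.≟ f u') then c else 0ℚ) ≡ π (f u') ℚ.* S u' u
    leaf-to-nonLeaf π S S-leaf u u' leaf nonLeaf = begin
      π (f u) ℚ.* (if does (f u FinP.≟ f u') then c else 0ℚ)
        ≡⟨ cong (λ b → π (f u) ℚ.* (if b then c else 0ℚ)) (dec-false (f u FinP.≟ f u') fu≢fu') ⟩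
      π (f u) ℚ.* 0ℚ       ≡⟨ ℚP.*-zeroʳ (π (f u)) ⟩
      0ℚ                   ≡⟨ ℚP.*-zeroʳ (π (f u')) ⟨
      π (f u') ℚ.* 0ℚ      ≡⟨ cong (π (f u') ℚ.*_) (S-leaf u' u leaf) ⟨
      π (f u') ℚ.* S u' u  ∎
      where
      open ≡-Reasoning
      fu≢fu' : f u ≢ f u'
      fu≢fu' fu≡fu' with () ← trans (sym leaf) (trans (cong isLeaf fu≡fu') nonLeaf)

  holdAtLeaves-detailedBalance : ∀ (π : Fin m → ℚ) (S : A → A → ℚ) →
                                 (∀ u u' → isLeaf (f u') ≡ true → S u u' ≡ 0ℚ) →
                                 DetailedBalance (π ∘ f) S → DetailedBalance (π ∘ f) (HoldAtLeaves S)
  holdAtLeaves-detailedBalance π S S-leaf balanced u u' with isLeaf (f u) in leaf | isLeaf (f u') in leaf'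
  ... | false | false = balanced u u'
  ... | true  | true  = hold-balanced π (f u) (f u')
  ... | true  | false = leaf-to-nonLeaf π S S-leaf u u' leaf leaf'
  ... | false | true  = sym (leaf-to-nonLeaf π S S-leaf u' u leaf' leaf)

module _ {m} (Γ : DoubleCover m) (LP RP : Fin m → ℕ) where
  open Walks Γ LP RP

  πq-sumsToOne : ∀ {C K} → 0 ℕ.< K → K ≡ sumℕ (λ i → if C i then LP i ℕ.* RP i else 0) → SumsToOneFin C (πq K)
  πq-sumsToOne {C} {K} 0<K K≡ = begin
    sumℚ (λ i → if C i then (LP i ℕ.* RP i) ÷ℕ K else 0ℚ)  ≡⟨ sumℚ-cong (λ i → if-÷ℕ (C i) (LP i ℕ.* RP i) K) ⟩
    sumℚ (λ i → (if C i then LP i ℕ.* RP i else 0) ÷ℕ K)  ≡⟨ sumℚ-÷ℕ (λ i → if C i then LP i ℕ.* RP i else 0) K ⟩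
    sumℕ (λ i → if C i then LP i ℕ.* RP i else 0) ÷ℕ K    ≡⟨ cong (_÷ℕ K) K≡ ⟨
    K ÷ℕ K                                                ≡⟨ n÷ℕn 0<K ⟩
    1ℚ                                                    ∎
    where open ≡-Reasoning

  πX-sumsToOne : ∀ C K → SumsToOneFin C (πq K) → SumsToOneX C (πX K)
  πX-sumsToOne C K = trans (sumℚ-cong fibre)
    where
    fibre : ∀ j → (if C j then πX K (j , false) else 0ℚ) ℚ.+ (if C j then πX K (j , true) else 0ℚ) ≡
                  (if C j then πq K j else 0ℚ)
    fibre j with C j
    ... | true  = ÷ℕ-double (LP j ℕ.* RP j) K
    ... | false = ℚP.+-identityʳ 0ℚ

  πq-dual : ∀ K i → πq K i ≡ Walks.πq (dual Γ) RP LP K i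
  πq-dual K i = cong (_÷ℕ K) (ℕP.*-comm (LP i) (RP i))

  P-down≡dual-P-up : ∀ u u' → P-down u u' ≡ Walks.P-up (dual Γ) RP LP u u'
  P-down≡dual-P-up u u' = cong (if rootᵇ Γ (proj₁ u) then _ else_) (sumX-cong term)
    where
    open DoubleCover Γ
    term : ∀ t → _ ≡ _
    term t = cong (λ b → if (t ⊂ u) ∧ (t ⊂ u') ∧ b
                         then (RP (proj₁ t) ℕ.* LP (proj₁ u')) ÷ℕ (RP (proj₁ u) ℕ.* LP (proj₁ t)) else 0ℚ)
                  (cong₂ _∧_ (sym (isSign-opposite Γ (sig u t) Sign.-)) (sym (isSign-opposite Γ (sig u' t) Sign.+)))

module UpWalk {m} (Γ : DoubleCover m) (LP RP : Fin m → ℕ) (isLP : IsLP Γ LP) (isRP : IsRP Γ RP) where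
  open DoubleCover Γ
  open Graph Γ using (_⋖_; leaf-⋖; ⋖⇒nonRoot; ⊂≡⋖; ⊂-negʳ)
  open Walks Γ LP RP

  LP-positive : ∀ i → 0 ℕ.< LP i
  LP-positive = Graph.LP-positive Γ LP isLP

  RP-positive : ∀ i → 0 ℕ.< RP i
  RP-positive = Graph.LP-positive (dual Γ) RP isRP

  step : Fin m → Fin m → Fin m → ℚ
  step u u' v = (LP v ℕ.* RP u') ÷ℕ (LP u ℕ.* RP v)

  step-balanced : ∀ K u u' v → πq K u ℚ.* step u u' v ≡ πq K u' ℚ.* step u' u v
  step-balanced K u u' v = begin
    πq K u ℚ.* step u u' v
      ≡⟨ balance K (LP u) (RP u) (RP u') (LP v) (RP v) (LP-positive u) (RP-positive v) ⟩
    (RP u ℕ.* RP u' ℕ.* LP v) ÷ℕ (K ℕ.* RP v)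
      ≡⟨ cong (λ n → (n ℕ.* LP v) ÷ℕ (K ℕ.* RP v)) (ℕP.*-comm (RP u) (RP u')) ⟩
    (RP u' ℕ.* RP u ℕ.* LP v) ÷ℕ (K ℕ.* RP v)
      ≡⟨ balance K (LP u') (RP u') (RP u) (LP v) (RP v) (LP-positive u') (RP-positive v) ⟨
    πq K u' ℚ.* step u' u v
      ∎
    where open ≡-Reasoning

  viaSibling : Fin m → Fin m → Fin m → ℚ
  viaSibling u u' v = if (u ⋖ v) ∧ (u' ⋖ v) then step u u' v else 0ℚ

  siblingSum : Fin m → Fin m → ℚ
  siblingSum u u' = sumℚ (viaSibling u u')

  siblingSum-leaf : ∀ u u' → leafᵇ Γ u' ≡ true → siblingSum u u' ≡ 0ℚ
  siblingSum-leaf u u' leaf = sumℚ-zero λ v →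
    cong (if_then step u u' v else 0ℚ) (trans (cong ((u ⋖ v) ∧_) (leaf-⋖ leaf)) (BoolP.∧-zeroʳ (u ⋖ v)))

  siblingSum-balanced : ∀ K → DetailedBalance (πq K) siblingSum
  siblingSum-balanced K u u' = begin
    πq K u ℚ.* siblingSum u u'                  ≡⟨ *-distribˡ-sumℚ (πq K u) (viaSibling u u') ⟩
    sumℚ (λ v → πq K u ℚ.* viaSibling u u' v)   ≡⟨ sumℚ-cong term ⟩
    sumℚ (λ v → πq K u' ℚ.* viaSibling u' u v)  ≡⟨ *-distribˡ-sumℚ (πq K u') (viaSibling u' u) ⟨
    πq K u' ℚ.* siblingSum u' u                 ∎
    where
    open ≡-Reasoning
    term : ∀ v → πq K u ℚ.* viaSibling u u' v ≡ πq K u' ℚ.* viaSibling u' u v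
    term v = trans (*-ifℚ (πq K u) _ (step u u' v))
                   (trans (cong₂ (if_then_else 0ℚ) (BoolP.∧-comm (u ⋖ v) (u' ⋖ v)) (step-balanced K u u' v))
                          (sym (*-ifℚ (πq K u') _ (step u' u v))))

  Pq-up-detailedBalance : ∀ K → DetailedBalance (πq K) Pq-up
  Pq-up-detailedBalance K =
    holdAtLeaves-detailedBalance (λ i → i) (leafᵇ Γ) 1ℚ (πq K) siblingSum siblingSum-leaf (siblingSum-balanced K)

  signedCover : Node m → Node m → Node m → Bool
  signedCover u u' v = (u ⊂ v) ∧ (u' ⊂ v) ∧ isSign Γ (sig v u) Sign.+ ∧ isSign Γ (sig v u') Sign.-

  signedCover-neg : ∀ u u' v → signedCover u' u (neg v) ≡ signedCover u u' v
  signedCover-neg u u' v rewrite ⊂-negʳ u v | ⊂-negʳ u' v with u ⊂ v in u⊂v | u' ⊂ v in u'⊂v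
  ... | true  | true  rewrite sig-negˡ u v u⊂v | sig-negˡ u' v u'⊂v =
    trans (cong₂ _∧_ (isSign-opposite Γ (sig v u') Sign.-) (isSign-opposite Γ (sig v u) Sign.+))
          (BoolP.∧-comm (isSign Γ (sig v u') Sign.-) (isSign Γ (sig v u) Sign.+))
  ... | true  | false = refl
  ... | false | true  = refl
  ... | false | false = refl

  signedCover-leaf : ∀ u i' b' v → leafᵇ Γ i' ≡ true → signedCover u (i' , b') v ≡ false
  signedCover-leaf u i' b' (j , c) leaf rewrite ⊂≡⋖ i' b' j c | leaf-⋖ {i'} {j} leaf = BoolP.∧-zeroʳ (u ⊂ (j , c))

  viaSigned : Node m → Node m → Node m → ℚ
  viaSigned u u' v = if signedCover u u' v then step (proj₁ u) (proj₁ u') (proj₁ v) else 0ℚ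

  signedSum : Node m → Node m → ℚ
  signedSum u u' = sumX (viaSigned u u')

  signedSum-leaf : ∀ u u' → leafᵇ Γ (proj₁ u') ≡ true → signedSum u u' ≡ 0ℚ
  signedSum-leaf u (i' , b') leaf =
    sumX-zero λ v → cong (if_then step (proj₁ u) i' (proj₁ v) else 0ℚ) (signedCover-leaf u i' b' v leaf)

  -- Pairing v with neg v exchanges the roles of u and u'.
  signedSum-balanced : ∀ K → DetailedBalance (πq K ∘ proj₁) signedSum
  signedSum-balanced K u u' = begin
    π u ℚ.* signedSum u u'                        ≡⟨ *-distribˡ-sumX (π u) (viaSigned u u') ⟩
    sumX (λ v → π u ℚ.* viaSigned u u' v)         ≡⟨ sumX-cong term ⟩
    sumX (λ v → π u' ℚ.* viaSigned u' u (neg v))  ≡⟨ sumX-neg (λ v → π u' ℚ.* viaSigned u' u v) ⟩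
    sumX (λ v → π u' ℚ.* viaSigned u' u v)        ≡⟨ *-distribˡ-sumX (π u') (viaSigned u' u) ⟨
    π u' ℚ.* signedSum u' u                       ∎
    where
    open ≡-Reasoning
    π = πq K ∘ proj₁
    term : ∀ v → π u ℚ.* viaSigned u u' v ≡ π u' ℚ.* viaSigned u' u (neg v)
    term v = trans (*-ifℚ (π u) _ _)
                   (trans (cong₂ (if_then_else 0ℚ) (sym (signedCover-neg u u' v))
                                                   (step-balanced K (proj₁ u) (proj₁ u') (proj₁ v)))
                          (sym (*-ifℚ (π u') _ _)))

  -- πX K is πq (2 K) on the underlying quotient node.
  P-up-detailedBalance : ∀ K → DetailedBalance (πX K) P-up
  P-up-detailedBalance K =
    holdAtLeaves-detailedBalance proj₁ (leafᵇ Γ) ½ (πq (2 ℕ.* K)) signedSum signedSum-leaf (signedSum-balanced (2 ℕ.* K))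

  siblingSum-outside : ∀ {C j i} → SiblingClosed Γ C → C j ≡ true → C i ≡ false → siblingSum j i ≡ 0ℚ
  siblingSum-outside {j = j} {i} closed Cj Ci = sumℚ-zero term
    where
    term : ∀ v → viaSibling j i v ≡ 0ℚ
    term v with j ⋖ v in j⋖v | i ⋖ v in i⋖v
    ... | true  | true  with () ← trans (sym (closed Cj j⋖v i⋖v)) Ci
    ... | true  | false = refl
    ... | false | _     = refl

  -- Summing over the targets i below v turns Σ RP i into RP v.
  siblingColumn : ∀ j v → sumℚ (λ i → viaSibling j i v) ≡ (if j ⋖ v then LP v else 0) ÷ℕ LP j
  siblingColumn j v with j ⋖ v in j⋖v
  ... | false = trans (sumℚ-zero {f = λ i → if false ∧ (i ⋖ v) then step j i v else 0ℚ} λ _ → refl) (sym (0÷ℕ (LP j)))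
  ... | true  = begin
    sumℚ (λ i → if i ⋖ v then step j i v else 0ℚ)
      ≡⟨ sumℚ-cong (λ i → if-÷ℕ (i ⋖ v) (LP v ℕ.* RP i) (LP j ℕ.* RP v)) ⟩
    sumℚ (λ i → (if i ⋖ v then LP v ℕ.* RP i else 0) ÷ℕ (LP j ℕ.* RP v))
      ≡⟨ sumℚ-÷ℕ (λ i → if i ⋖ v then LP v ℕ.* RP i else 0) (LP j ℕ.* RP v) ⟩
    sumℕ (λ i → if i ⋖ v then LP v ℕ.* RP i else 0) ÷ℕ (LP j ℕ.* RP v)
      ≡⟨ cong (_÷ℕ (LP j ℕ.* RP v)) lowerSum ⟩
    (LP v ℕ.* RP v) ÷ℕ (LP j ℕ.* RP v)
      ≡⟨ ÷ℕ-cross (LP v ℕ.* RP v) (LP v) (ℕP.*-mono-< (LP-positive j) (RP-positive v)) (LP-positive j)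
                  (eq (LP v) (RP v) (LP j)) ⟩
    LP v ÷ℕ LP j
      ∎
    where
    open ≡-Reasoning
    lowerSum : sumℕ (λ i → if i ⋖ v then LP v ℕ.* RP i else 0) ≡ LP v ℕ.* RP v
    lowerSum = begin
      sumℕ (λ i → if i ⋖ v then LP v ℕ.* RP i else 0)    ≡⟨ sumℕ-cong (λ i → *-ifℕ (LP v) (i ⋖ v) (RP i)) ⟨
      sumℕ (λ i → LP v ℕ.* (if i ⋖ v then RP i else 0))
        ≡⟨ *-distribˡ-sumℕ (LP v) (λ i → if i ⋖ v then RP i else 0) ⟨
      LP v ℕ.* sumℕ (λ i → if i ⋖ v then RP i else 0)
        ≡⟨ cong (LP v ℕ.*_) (Graph.LP-nonLeaf (dual Γ) RP isRP (⋖⇒nonRoot j⋖v)) ⟨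
      LP v ℕ.* RP v                                      ∎
    eq : ∀ a b c → a ℕ.* b ℕ.* c ≡ a ℕ.* (c ℕ.* b)
    eq = solve-∀

  Pq-up-rowSum : ∀ {C} → SiblingClosed Γ C → ∀ j → C j ≡ true → sumℚ (λ i → if C i then Pq-up j i else 0ℚ) ≡ 1ℚ
  Pq-up-rowSum {C} closed j Cj with leafᵇ Γ j in leaf
  ... | true  = trans (sumℚ-single _ j offDiagonal) diagonal
    where
    offDiagonal : ∀ i → j ≢ i → (if C i then (if does (j FinP.≟ i) then 1ℚ else 0ℚ) else 0ℚ) ≡ 0ℚ
    offDiagonal i j≢i rewrite dec-false (j FinP.≟ i) j≢i with C i
    ... | true  = refl
    ... | false = refl
    diagonal : (if C j then (if does (j FinP.≟ j) then 1ℚ else 0ℚ) else 0ℚ) ≡ 1ℚ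
    diagonal rewrite Cj | dec-true (j FinP.≟ j) refl = refl
  ... | false = begin
    sumℚ (λ i → if C i then siblingSum j i else 0ℚ)   ≡⟨ sumℚ-cong restrict ⟩
    sumℚ (λ i → sumℚ (viaSibling j i))                ≡⟨ sumℚ-comm (viaSibling j) ⟩
    sumℚ (λ v → sumℚ (λ i → viaSibling j i v))        ≡⟨ sumℚ-cong (siblingColumn j) ⟩
    sumℚ (λ v → (if j ⋖ v then LP v else 0) ÷ℕ LP j)  ≡⟨ sumℚ-÷ℕ (λ v → if j ⋖ v then LP v else 0) (LP j) ⟩
    sumℕ (λ v → if j ⋖ v then LP v else 0) ÷ℕ LP j    ≡⟨ cong (_÷ℕ LP j) (Graph.LP-nonLeaf Γ LP isLP leaf) ⟨
    LP j ÷ℕ LP j                                      ≡⟨ n÷ℕn (LP-positive j) ⟩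
    1ℚ                                                ∎
    where
    open ≡-Reasoning
    restrict : ∀ i → (if C i then siblingSum j i else 0ℚ) ≡ siblingSum j i
    restrict i with C i in Ci
    ... | true  = refl
    ... | false = sym (siblingSum-outside closed Cj Ci)

StationaryOn : ∀ {m} → (Fin m → Bool) → (Fin m → ℚ) → (Fin m → Fin m → ℚ) →
               (Node m → ℚ) → (Node m → Node m → ℚ) → Set
StationaryOn C π Pq πX P =
  SumsToOneFin C π × Reversible C π Pq × StationaryFin C π Pq × SumsToOneX C πX × Reversible (λ u → C (proj₁ u)) πX P

module _ {m} (Γ : DoubleCover m) (graded : StronglyGraded Γ) (LP RP : Fin m → ℕ) (isLP : IsLP Γ LP) (isRP : IsRP Γ RP) where
  open Walks Γ LP RP
  module Up   = UpWalk Γ LP RP isLP isRP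
  module Down = UpWalk (dual Γ) RP LP isRP isLP

  component-sumsToOne : ∀ {k Adj C ps} → IsComponent Γ k Adj C → EnumeratesPathsThrough Γ C ps →
                        SumsToOneFin C (πq (length ps)) × SumsToOneX C (πX (length ps))
  component-sumsToOne {k} {C = C} {ps} ((C-level , _) , (i , Ci) , _) enumeration =
    sums , πX-sumsToOne Γ LP RP C (length ps) sums
    where
    weights = λ i → if C i then LP i ℕ.* RP i else 0
    K≡ : length ps ≡ sumℕ weights
    K≡ = PathCount.pathCount Γ LP RP isLP isRP k C C-level enumeration
    weight-positive : 0 ℕ.< weights i
    weight-positive rewrite Ci = ℕP.*-mono-< (Up.LP-positive i) (Up.RP-positive i)
    sums : SumsToOneFin C (πq (length ps))
    sums = πq-sumsToOne Γ LP RP (subst (0 ℕ.<_) (sym K≡) (ℕP.<-≤-trans weight-positive (term≤sumℕ weights i))) K≡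

  upComponent-stationary : ∀ k C ps → IsUpComponent Γ k C → EnumeratesPathsThrough Γ C ps →
                           StationaryOn C (πq (length ps)) Pq-up (πX (length ps)) P-up
  upComponent-stationary _ C ps component enumeration = let sums , sumsX = component-sumsToOne component enumeration in
    sums , reversible , reversible⇒stationary C (πq K) Pq-up reversible rowSum , sumsX , reversibleX
    where
    K = length ps
    reversible : Reversible C (πq K) Pq-up
    reversible u u' _ _ = Up.Pq-up-detailedBalance K u u'
    rowSum = Up.Pq-up-rowSum (upComponent-siblingClosed Γ graded component)
    reversibleX : Reversible (λ u → C (proj₁ u)) (πX K) P-up
    reversibleX u u' _ _ = Up.P-up-detailedBalance K u u'

  downComponent-stationary : ∀ k C ps → IsDownComponent Γ k C → EnumeratesPathsThrough Γ C ps →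
                             StationaryOn C (πq (length ps)) Pq-down (πX (length ps)) P-down
  downComponent-stationary _ C ps component enumeration = let sums , sumsX = component-sumsToOne component enumeration in
    sums , reversible , reversible⇒stationary C (πq K) Pq-down reversible rowSum , sumsX , reversibleX
    where
    K = length ps
    reversible : Reversible C (πq K) Pq-down
    reversible u u' _ _ = detailedBalance-resp (πq-dual Γ LP RP K) (λ _ _ → refl) (Down.Pq-up-detailedBalance K) u u'
    rowSum = Down.Pq-up-rowSum (downComponent-siblingClosed Γ graded component)
    reversibleX : Reversible (λ u → C (proj₁ u)) (πX K) P-down
    reversibleX u u' _ _ =
      detailedBalance-resp (πq-dual Γ LP RP (2 ℕ.* K) ∘ proj₁) (P-down≡dual-P-up Γ LP RP) (Down.P-up-detailedBalance K) u u'

theorem1p48 : ∀ {m} (Γ : DoubleCover m) → StronglyGraded Γ →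
    (LP RP : Fin m → ℕ) → IsLP Γ LP → IsRP Γ RP →
    (∀ (k : ℤ) (C : Fin m → Bool) (ps : List (List (Fin m))) →
       IsUpComponent Γ k C → EnumeratesPathsThrough Γ C ps →
       SumsToOneFin C (Walks.πq Γ LP RP (length ps)) ×
       Reversible C (Walks.πq Γ LP RP (length ps)) (Walks.Pq-up Γ LP RP) ×
       StationaryFin C (Walks.πq Γ LP RP (length ps)) (Walks.Pq-up Γ LP RP) ×
       SumsToOneX C (Walks.πX Γ LP RP (length ps)) ×
       Reversible (λ u → C (proj₁ u)) (Walks.πX Γ LP RP (length ps)) (Walks.P-up Γ LP RP)) ×
    (∀ (k : ℤ) (C : Fin m → Bool) (ps : List (List (Fin m))) →
       IsDownComponent Γ k C → EnumeratesPathsThrough Γ C ps →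
       SumsToOneFin C (Walks.πq Γ LP RP (length ps)) ×
       Reversible C (Walks.πq Γ LP RP (length ps)) (Walks.Pq-down Γ LP RP) ×
       StationaryFin C (Walks.πq Γ LP RP (length ps)) (Walks.Pq-down Γ LP RP) ×
       SumsToOneX C (Walks.πX Γ LP RP (length ps)) ×
       Reversible (λ u → C (proj₁ u)) (Walks.πX Γ LP RP (length ps)) (Walks.P-down Γ LP RP))
theorem1p48 Γ graded LP RP isLP isRP =
  upComponent-stationary Γ graded LP RP isLP isRP , downComponent-stationary Γ graded LP RP isLP isRP
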